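{- Let $n\geqslant 2$ and $k\geqslant 3$ be integers and let $D_n^k$ be the Dutch windmill graph, i.e. the graph obtained from $n$ pairwise disjoint copies of the cycle $C_k$ by identifying one vertex from each copy into a single common vertex. Then $$D(D_n^k)=\min\Big\{r\in\mathbb{N} : \frac{r^{k-1}-r^{\lceil (k-1)/2\rceil}}{2}\geqslant n\Big\}.$$
   Context: For a graph $G$, a vertex labeling $\phi:V(G)\to\{1,\dots,r\}$ is $r$-distinguishing if the only automorphism $\sigma$ of $G$ with $\phi(x)=\phi(\sigma(x))$ for all $x\in V(G)$ is the identity. The distinguishing number $D(G)$ is the least $r$ such that $G$ has an $r$-distinguishing vertex labeling. -}

module Defs where

open import Data.Nat using (ℕ; zero; suc; _+_; _*_; _∸_; _^_; _≤_; _<_; ⌈_/2⌉)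
open import Data.Nat.DivMod using (_/_)
open import Data.Fin using (Fin; toℕ)
open import Data.Maybe using (Maybe; just; nothing)
open import Data.Product using (_×_; _,_; Σ; ∃)
open import Data.Sum using (_⊎_)
open import Function.Bundles using (_↔_; Inverse; _⇔_)
open import Relation.Binary.PropositionalEquality using (_≡_)
open import Relation.Nullary using (¬_)

record Graph : Set₁ where
  field
    V   : Set
    Adj : V → V → Set
open Graph public

record Automorphism (G : Graph) : Set where
  field
    perm     : V G ↔ V G
    preserve : ∀ x y → Adj G x y ⇔ Adj G (Inverse.to perm x) (Inverse.to perm y)
open Automorphism public

IsDistinguishing : (G : Graph) (r : ℕ) → (V G → Fin r) → Set
IsDistinguishing G r φ =
  (σ : Automorphism G) →
  (∀ x → φ x ≡ φ (Inverse.to (perm σ) x)) →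
  ∀ x → Inverse.to (perm σ) x ≡ x

HasDistinguishingLabeling : Graph → ℕ → Set
HasDistinguishingLabeling G r = Σ (V G → Fin r) (IsDistinguishing G r)

IsLeast : (ℕ → Set) → ℕ → Set
IsLeast P m = P m × (∀ s → P s → m ≤ s)

DistinguishingNumberIs : Graph → ℕ → Set
DistinguishingNumberIs G m = IsLeast (HasDistinguishingLabeling G) m

-- Dutch windmill graph D_n^k: vertices are the hub (nothing) and, for each copy
-- i : Fin n of C_k, the k-1 non-hub vertices just (i , j), j : Fin (k ∸ 1),
-- forming the cycle hub – (i,0) – (i,1) – … – (i,k-2) – hub.
data WEdge (n k : ℕ) : Maybe (Fin n × Fin (k ∸ 1)) → Maybe (Fin n × Fin (k ∸ 1)) → Set where
  hub-first : ∀ i j → toℕ j ≡ 0 → WEdge n k nothing (just (i , j))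
  hub-last  : ∀ i j → toℕ j ≡ k ∸ 2 → WEdge n k nothing (just (i , j))
  step      : ∀ i j j' → suc (toℕ j) ≡ toℕ j' → WEdge n k (just (i , j)) (just (i , j'))

DutchWindmill : ℕ → ℕ → Graph
DutchWindmill n k = record
  { V   = Maybe (Fin n × Fin (k ∸ 1))
  ; Adj = λ x y → WEdge n k x y ⊎ WEdge n k y x
  }

-- The condition (r^(k-1) - r^⌈(k-1)/2⌉)/2 ≥ n (the numerator is a natural number).
WindmillBound : ℕ → ℕ → ℕ → Set
WindmillBound n k r = n ≤ (r ^ (k ∸ 1) ∸ r ^ ⌈ k ∸ 1 /2⌉) / 2

-- Reading the labels along a blade (a copy of C_k minus the hub) from one hub-neighbour to the other
-- gives a word of length L = k - 1. Automorphisms fix the hub, which has 2n ≥ 4 neighbours while every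
-- other vertex has two, so they permute the blades, possibly reversing some; conversely every such
-- permutation is an automorphism. Hence a labelling is distinguishing iff the blade words are
-- non-palindromic and pairwise distinct up to reversal, and D(D_n^k) is the least r for which the number
-- N(L) of reversal classes of non-palindromic words of length L over r letters is at least n. Comparing
-- the two outer letters of a word gives a recursion for N, from which 2 N(L) + r^⌈L/2⌉ = r^L.

module Submission where

open import Defs
open import Level using (0ℓ)
open import Data.Nat as ℕ using (ℕ; zero; suc; _+_; _*_; _∸_; _^_; _≤_; z≤n; s≤s; ⌈_/2⌉)
import Data.Nat.Properties as ℕ
open import Data.Nat.DivMod using (_/_; m*n/n≡m)
open import Data.Nat.Tactic.RingSolver using (solve-∀)
open import Data.Fin
  using (Fin; zero; suc; toℕ; fromℕ; inject₁; inject≤; opposite; _↑ˡ_; _↑ʳ_; splitAt; combine; remQuot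
        ; _<_; _≟_)
open import Data.Fin.Properties
  using ( toℕ-injective; toℕ<n; toℕ-inject₁; opposite-prop; opposite-involutive; splitAt-↑ˡ; splitAt-↑ʳ
        ; splitAt⁻¹-↑ˡ; splitAt⁻¹-↑ʳ; ↑ˡ-injective; ↑ʳ-injective; combine-remQuot; combine-injective
        ; <-cmp; <-irrelevant; <⇒≢; injective⇒≤; inject≤-injective)
open import Data.Fin.Relation.Unary.Top using (view; ‵fromℕ; ‵inject₁; view-fromℕ; view-inject₁)
open import Data.Fin.Induction using (<-weakInduction)
open import Data.Vec.Functional using (Vector; []; _∷_; head; tail; uncons; init; last; reverse)
open import Data.Maybe using (nothing; just)
open import Data.Maybe.Properties using (just-injective)
open import Data.Bool using (Bool; true; false; if_then_else_)
open import Data.Product using (Σ; ∃; ∃₂; _×_; _,_; proj₁; proj₂; uncurry)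
import Data.Product as Product
import Data.Product.Relation.Binary.Pointwise.NonDependent as ×
open import Data.Sum using (_⊎_; inj₁; inj₂)
import Data.Sum as Sum
open import Data.Sum.Relation.Binary.Pointwise as ⊎ using (inj₁; inj₂; ≡⇒Pointwise-≡; Pointwise-≡⇒≡)
open import Function using (_∘_; id; _on_; Injective; _⇔_; Equivalence; mk⇔; mk↔ₛ′; Inverse; Injection)
open import Function.Properties.Inverse using (↔⇒↣)
open import Function.Construct.Symmetry using (⇔-sym)
open import Relation.Unary using (Decidable)
open import Relation.Binary using (Rel; Tri; tri<; tri≈; tri>; _Preserves_⟶_)
open import Relation.Binary.PropositionalEquality
  using (_≡_; _≢_; _≗_; refl; sym; trans; cong; cong₂; subst; subst₂; module ≡-Reasoning)
open import Relation.Nullary using (¬_; yes; no; does; contradiction)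
open import Relation.Nullary.Decidable using (dec-true; dec-false)
open import Axiom.UniquenessOfIdentityProofs using (module Decidable⇒UIP)

-- Enumerations up to a relation

-- Fin N is in bijection with the ∼-classes of A.
record Enumeration {A : Set} (_∼_ : Rel A 0ℓ) (N : ℕ) : Set where
  field
    encode           : A → Fin N
    decode           : Fin N → A
    encode-decode    : ∀ i → encode (decode i) ≡ i
    encode-injective : ∀ {x y} → encode x ≡ encode y → x ∼ y
    encode-cong      : ∀ {x y} → x ∼ y → encode x ≡ encode y

empty-enumeration : ∀ {A : Set} {_∼_ : Rel A 0ℓ} → ¬ A → Enumeration _∼_ 0
empty-enumeration ¬a = record
  { encode           = λ x → contradiction x ¬a
  ; decode           = λ ()
  ; encode-decode    = λ ()
  ; encode-injective = λ {x} _ → contradiction x ¬a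
  ; encode-cong      = λ {x} _ → contradiction x ¬a
  }

fin-enumeration : ∀ {N} → Enumeration {Fin N} _≡_ N
fin-enumeration = record
  { encode           = λ i → i
  ; decode           = λ i → i
  ; encode-decode    = λ _ → refl
  ; encode-injective = λ e → e
  ; encode-cong      = λ e → e
  }

↑ˡ≢↑ʳ : ∀ {m n} (i : Fin m) (j : Fin n) → i ↑ˡ n ≢ m ↑ʳ j
↑ˡ≢↑ʳ {m} {n} i j e
  with () ← trans (sym (splitAt-↑ˡ m i n)) (trans (cong (splitAt m) e) (splitAt-↑ʳ m n j))

module _ {A B : Set} {_∼_ : Rel A 0ℓ} {_≈_ : Rel B 0ℓ} {m n : ℕ} where

  ⊎-enumeration : Enumeration _∼_ m → Enumeration _≈_ n → Enumeration (⊎.Pointwise _∼_ _≈_) (m + n)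
  ⊎-enumeration E F = record
    { encode           = encode
    ; decode           = Sum.map E.decode F.decode ∘ splitAt m
    ; encode-decode    = encode-decode
    ; encode-injective = encode-injective
    ; encode-cong      = encode-cong
    }
    where
    module E = Enumeration E
    module F = Enumeration F

    encode : A ⊎ B → Fin (m + n)
    encode (inj₁ x) = E.encode x ↑ˡ n
    encode (inj₂ y) = m ↑ʳ F.encode y

    encode-decode : ∀ i → encode (Sum.map E.decode F.decode (splitAt m i)) ≡ i
    encode-decode i with splitAt m i in eq
    ... | inj₁ k = trans (cong (_↑ˡ n) (E.encode-decode k)) (splitAt⁻¹-↑ˡ eq)
    ... | inj₂ k = trans (cong (m ↑ʳ_) (F.encode-decode k)) (splitAt⁻¹-↑ʳ eq)

    encode-injective : ∀ {x y} → encode x ≡ encode y → ⊎.Pointwise _∼_ _≈_ x y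
    encode-injective {inj₁ x} {inj₁ y} e = inj₁ (E.encode-injective (↑ˡ-injective n _ _ e))
    encode-injective {inj₁ x} {inj₂ y} e = contradiction e (↑ˡ≢↑ʳ _ _)
    encode-injective {inj₂ x} {inj₁ y} e = contradiction (sym e) (↑ˡ≢↑ʳ _ _)
    encode-injective {inj₂ x} {inj₂ y} e = inj₂ (F.encode-injective (↑ʳ-injective m _ _ e))

    encode-cong : ∀ {x y} → ⊎.Pointwise _∼_ _≈_ x y → encode x ≡ encode y
    encode-cong (inj₁ p) = cong (_↑ˡ n) (E.encode-cong p)
    encode-cong (inj₂ q) = cong (m ↑ʳ_) (F.encode-cong q)

  ×-enumeration : Enumeration _∼_ m → Enumeration _≈_ n → Enumeration (×.Pointwise _∼_ _≈_) (m * n)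
  ×-enumeration E F = record
    { encode           = λ p → combine (E.encode (proj₁ p)) (F.encode (proj₂ p))
    ; decode           = Product.map E.decode F.decode ∘ remQuot {m} n
    ; encode-decode    = λ i →
        trans (cong₂ combine (E.encode-decode _) (F.encode-decode _)) (combine-remQuot {m} n i)
    ; encode-injective = Product.map E.encode-injective F.encode-injective ∘ combine-injective _ _ _ _
    ; encode-cong      = λ (p , q) → cong₂ combine (E.encode-cong p) (F.encode-cong q)
    }
    where
    module E = Enumeration E
    module F = Enumeration F

enumeration-via : ∀ {A B : Set} {_∼_ : Rel A 0ℓ} {_≈_ : Rel B 0ℓ} {N} (f : A → B) (g : B → A) →
                  (∀ {x y} → x ∼ y → f x ≈ f y) → (∀ {x y} → f x ≈ f y → x ∼ y) →
                  (∀ b → f (g b) ≈ b) →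
                  Enumeration _≈_ N → Enumeration _∼_ N
enumeration-via f g f-cong f-reflects f∘g E = record
  { encode           = encode ∘ f
  ; decode           = g ∘ decode
  ; encode-decode    = λ i → trans (encode-cong (f∘g (decode i))) (encode-decode i)
  ; encode-injective = f-reflects ∘ encode-injective
  ; encode-cong      = encode-cong ∘ f-cong
  }
  where open Enumeration E

-- Increasing pairs, words and palindromes

Increasing : ℕ → Set
Increasing r = Σ (Fin r × Fin r) (uncurry _<_)

-- triangle r = r C 2
triangle : ℕ → ℕ
triangle zero    = 0
triangle (suc r) = r + triangle r

triangle-double : ∀ r → triangle r * 2 + r ≡ r * r
triangle-double zero    = refl
triangle-double (suc r) = begin
  (r + triangle r) * 2 + suc r        ≡⟨ regroup r (triangle r) ⟩
  (triangle r * 2 + r) + (r + suc r)  ≡⟨ cong (_+ (r + suc r)) (triangle-double r) ⟩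
  r * r + (r + suc r)                 ≡⟨ square-suc r ⟩
  suc r * suc r                       ∎
  where
  open ≡-Reasoning
  regroup : ∀ r t → (r + t) * 2 + suc r ≡ (t * 2 + r) + (r + suc r)
  regroup = solve-∀
  square-suc : ∀ r → r * r + (r + suc r) ≡ suc r * suc r
  square-suc = solve-∀

increasing-enumeration : ∀ r → Enumeration {Increasing r} _≡_ (triangle r)
increasing-enumeration zero    = empty-enumeration λ { ((() , _) , _) }
increasing-enumeration (suc r) =
  enumeration-via split unsplit (≡⇒Pointwise-≡ ∘ cong split) (split-injective ∘ Pointwise-≡⇒≡)
                  (≡⇒Pointwise-≡ ∘ split-unsplit) (⊎-enumeration fin-enumeration (increasing-enumeration r))
  where
  split : Increasing (suc r) → Fin r ⊎ Increasing r
  split ((zero  , suc b) , _)         = inj₁ b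
  split ((suc a , suc b) , s≤s a<b)   = inj₂ ((a , b) , a<b)

  unsplit : Fin r ⊎ Increasing r → Increasing (suc r)
  unsplit (inj₁ b)              = (zero , suc b) , s≤s z≤n
  unsplit (inj₂ ((a , b) , a<b)) = (suc a , suc b) , s≤s a<b

  split-unsplit : ∀ p → split (unsplit p) ≡ p
  split-unsplit (inj₁ _) = refl
  split-unsplit (inj₂ _) = refl

  unsplit-split : ∀ p → unsplit (split p) ≡ p
  unsplit-split ((zero  , suc b) , s≤s z≤n) = refl
  unsplit-split ((suc a , suc b) , s≤s a<b) = refl

  split-injective : ∀ {p q} → split p ≡ split q → p ≡ q
  split-injective {p} {q} e = trans (sym (unsplit-split p)) (trans (cong unsplit e) (unsplit-split q))

opposite-inject₁ : ∀ {n} (i : Fin n) → opposite (inject₁ i) ≡ suc (opposite i)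
opposite-inject₁ {suc n} zero    = refl
opposite-inject₁ {suc n} (suc i) = cong inject₁ (opposite-inject₁ i)

opposite-fromℕ : ∀ n → opposite (fromℕ n) ≡ zero
opposite-fromℕ zero    = refl
opposite-fromℕ (suc n) = cong inject₁ (opposite-fromℕ n)

opposite-step : ∀ {n} {j j′ : Fin n} →
                suc (toℕ j) ≡ toℕ j′ → suc (toℕ (opposite j′)) ≡ toℕ (opposite j)
opposite-step {n} {j} {j′} e = begin
  suc (toℕ (opposite j′))      ≡⟨ cong suc (opposite-prop j′) ⟩
  suc (n ∸ suc (toℕ j′))       ≡⟨ cong (λ t → suc (n ∸ suc t)) e ⟨
  suc (n ∸ suc (suc (toℕ j)))  ≡⟨ ℕ.+-∸-assoc 1 (subst (_≤ n) (sym (cong suc e)) (toℕ<n j′)) ⟨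
  n ∸ suc (toℕ j)              ≡⟨ opposite-prop j ⟨
  toℕ (opposite j)             ∎
  where open ≡-Reasoning

module _ {A : Set} {n : ℕ} where

  _∷ʳ_ : Vector A n → A → Vector A (suc n)
  (u ∷ʳ b) i with view i
  ... | ‵fromℕ     = b
  ... | ‵inject₁ j = u j

  last-∷ʳ : ∀ (u : Vector A n) b → last (u ∷ʳ b) ≡ b
  last-∷ʳ u b rewrite view-fromℕ n = refl

  init-∷ʳ : ∀ (u : Vector A n) b → init (u ∷ʳ b) ≗ u
  init-∷ʳ u b j rewrite view-inject₁ j = refl

  reverse-involutive : ∀ (u : Vector A n) → reverse (reverse u) ≗ u
  reverse-involutive u j = cong u (opposite-involutive j)

  ≗-reverseˡ : ∀ {u v : Vector A n} → reverse u ≗ v → u ≗ reverse v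
  ≗-reverseˡ {u} e j = trans (sym (cong u (opposite-involutive j))) (e (opposite j))

  ≗-reverseʳ : ∀ {u v : Vector A n} → u ≗ reverse v → reverse u ≗ v
  ≗-reverseʳ {v = v} e j = trans (e (opposite j)) (cong v (opposite-involutive j))

module _ {A : Set} {L : ℕ} where

  inner : Vector A (2 + L) → Vector A L
  inner w = init (tail w)

  wrap : A → Vector A L → A → Vector A (2 + L)
  wrap a u b = a ∷ (u ∷ʳ b)

  ≗-ends : ∀ {w v : Vector A (2 + L)} →
           head w ≡ head v → last w ≡ last v → inner w ≗ inner v → w ≗ v
  ≗-ends h l i zero = h
  ≗-ends h l i (suc j) with view j
  ... | ‵fromℕ      = l
  ... | ‵inject₁ j′ = i j′

  last-reverse : ∀ (w : Vector A (2 + L)) → last (reverse w) ≡ head w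
  last-reverse w = cong w (opposite-fromℕ (suc L))

  inner-reverse : ∀ (w : Vector A (2 + L)) → inner (reverse w) ≗ reverse (inner w)
  inner-reverse w j = cong (w ∘ inject₁) (opposite-inject₁ j)

-- Reversal classes of non-palindromic words

module Words (r : ℕ) where

  Word : ℕ → Set
  Word = Vector (Fin r)

  Palindrome : ∀ {L} → Word L → Set
  Palindrome w = w ≗ reverse w

  palindrome-cong : ∀ {L} {u v : Word L} → u ≗ v → Palindrome u → Palindrome v
  palindrome-cong {v = v} e p j = trans (sym (e j)) (trans (p j) (e (opposite j)))

  module _ {L : ℕ} {w : Word (2 + L)} where

    palindrome-ends : Palindrome w → head w ≡ last w
    palindrome-ends p = p zero

    palindrome-inner : Palindrome w → Palindrome (inner w)
    palindrome-inner p j = trans (p (suc (inject₁ j))) (inner-reverse w j)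

    palindrome-from-ends : head w ≡ last w → Palindrome (inner w) → Palindrome w
    palindrome-from-ends h p =
      ≗-ends h (trans (sym h) (sym (last-reverse w))) (λ j → trans (p j) (sym (inner-reverse w j)))

  word-enumeration : ∀ L → Enumeration {Word L} _≗_ (r ^ L)
  word-enumeration zero    = record
    { encode           = λ _ → zero
    ; decode           = λ _ → []
    ; encode-decode    = λ { zero → refl }
    ; encode-injective = λ _ ()
    ; encode-cong      = λ _ → refl
    }
  word-enumeration (suc L) =
    enumeration-via uncons (uncurry _∷_) (λ e → e zero , e ∘ suc)
                    (λ (e₀ , e) → λ { zero → e₀ ; (suc j) → e j }) (λ _ → refl , λ _ → refl)
                    (×-enumeration fin-enumeration (word-enumeration L))

  _≈ᴿ_ : ∀ {L} → Rel (Word L) 0ℓ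
  u ≈ᴿ v = u ≗ v ⊎ u ≗ reverse v

  NonPalindrome : ℕ → Set
  NonPalindrome L = Σ (Word L) (¬_ ∘ Palindrome)

  -- A class with outer letters a ≠ b has a unique member with a < b, and its interior is arbitrary;
  -- a class with outer letters a = a is determined by a and the class of its non-palindromic interior.
  nonPalindromeClasses : ℕ → ℕ
  nonPalindromeClasses 0               = 0
  nonPalindromeClasses 1               = 0
  nonPalindromeClasses (suc (suc L)) = triangle r * r ^ L + r * nonPalindromeClasses L

  module _ {L : ℕ} where

    Code : Set
    Code = (Increasing r × Word L) ⊎ (Fin r × NonPalindrome L)

    _≈ᶜ_ : Rel Code 0ℓ
    _≈ᶜ_ = ⊎.Pointwise (×.Pointwise _≡_ _≗_) (×.Pointwise _≡_ (_≈ᴿ_ on proj₁))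

    classify : (a b : Fin r) (u : Word L) → (a ≡ b → ¬ Palindrome u) → Tri (a < b) (a ≡ b) (b < a) → Code
    classify a b u np (tri< a<b _ _) = inj₁ (((a , b) , a<b) , u)
    classify a b u np (tri≈ _ a≡b _) = inj₂ (a , u , np a≡b)
    classify a b u np (tri> _ _ b<a) = inj₁ (((b , a) , b<a) , reverse u)

    module _ {a b : Fin r} {u : Word L} {np : a ≡ b → ¬ Palindrome u} where

      classify-< : (a<b : a < b) → ∀ t → classify a b u np t ≡ inj₁ (((a , b) , a<b) , u)
      classify-< a<b (tri< a<b′ _ _) = cong (λ p → inj₁ (((a , b) , p) , u)) (<-irrelevant a<b′ a<b)
      classify-< a<b (tri≈ a≮b _ _)  = contradiction a<b a≮b
      classify-< a<b (tri> a≮b _ _)  = contradiction a<b a≮b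

      classify-≡ : (a≡b : a ≡ b) → ∀ t → classify a b u np t ≡ inj₂ (a , u , np a≡b)
      classify-≡ a≡b (tri< _ a≢b _)  = contradiction a≡b a≢b
      classify-≡ a≡b (tri≈ _ a≡b′ _) =
        cong (λ e → inj₂ (a , u , np e)) (Decidable⇒UIP.≡-irrelevant _≟_ a≡b′ a≡b)
      classify-≡ a≡b (tri> _ a≢b _)  = contradiction a≡b a≢b

      classify-> : (b<a : b < a) → ∀ t → classify a b u np t ≡ inj₁ (((b , a) , b<a) , reverse u)
      classify-> b<a (tri< _ _ b≮a)  = contradiction b<a b≮a
      classify-> b<a (tri≈ _ _ b≮a)  = contradiction b<a b≮a
      classify-> b<a (tri> _ _ b<a′) =
        cong (λ p → inj₁ (((b , a) , p) , reverse u)) (<-irrelevant b<a′ b<a)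

    module _ {a b a′ b′ : Fin r} {u u′ : Word L}
             {np : a ≡ b → ¬ Palindrome u} {np′ : a′ ≡ b′ → ¬ Palindrome u′} where

      classify-cong : a ≡ a′ → b ≡ b′ → u ≗ u′ →
                      ∀ t t′ → classify a b u np t ≈ᶜ classify a′ b′ u′ np′ t′
      classify-cong refl refl u≗u′ (tri< a<b _ _) t′
        rewrite classify-< {np = np′} a<b t′ = inj₁ (refl , u≗u′)
      classify-cong refl refl u≗u′ (tri≈ _ a≡b _) t′
        rewrite classify-≡ {np = np′} a≡b t′ = inj₂ (refl , inj₁ u≗u′)
      classify-cong refl refl u≗u′ (tri> _ _ b<a) t′
        rewrite classify-> {np = np′} b<a t′ = inj₁ (refl , u≗u′ ∘ opposite)

      classify-cong-reverse : a ≡ b′ → b ≡ a′ → u ≗ reverse u′ →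
                              ∀ t t′ → classify a b u np t ≈ᶜ classify a′ b′ u′ np′ t′
      classify-cong-reverse refl refl u≗ru′ (tri< a<b _ _) t′
        rewrite classify-> {np = np′} a<b t′ = inj₁ (refl , u≗ru′)
      classify-cong-reverse refl refl u≗ru′ (tri≈ _ a≡b _) t′
        rewrite classify-≡ {np = np′} (sym a≡b) t′ = inj₂ (a≡b , inj₂ u≗ru′)
      classify-cong-reverse refl refl u≗ru′ (tri> _ _ b<a) t′
        rewrite classify-< {np = np′} b<a t′ = inj₁ (refl , ≗-reverseʳ u≗ru′)

      classify-injective : ∀ t t′ → classify a b u np t ≈ᶜ classify a′ b′ u′ np′ t′ →
                           (a ≡ a′ × b ≡ b′ × u ≗ u′) ⊎ (a ≡ b′ × b ≡ a′ × u ≗ reverse u′)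
      classify-injective (tri< _ _ _) (tri< _ _ _) (inj₁ (refl , e)) = inj₁ (refl , refl , e)
      classify-injective (tri< _ _ _) (tri> _ _ _) (inj₁ (refl , e)) = inj₂ (refl , refl , e)
      classify-injective (tri> _ _ _) (tri< _ _ _) (inj₁ (refl , e)) = inj₂ (refl , refl , ≗-reverseˡ e)
      classify-injective (tri> _ _ _) (tri> _ _ _) (inj₁ (refl , e)) =
        inj₁ (refl , refl , λ j → trans (≗-reverseˡ e j) (reverse-involutive u′ j))
      classify-injective (tri≈ _ a≡b _) (tri≈ _ a≡b′ _) (inj₂ (refl , inj₁ e)) =
        inj₁ (refl , trans (sym a≡b) a≡b′ , e)
      classify-injective (tri≈ _ a≡b _) (tri≈ _ a≡b′ _) (inj₂ (refl , inj₂ e)) =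
        inj₂ (a≡b′ , sym a≡b , e)
      classify-injective (tri< _ _ _) (tri≈ _ _ _) ()
      classify-injective (tri> _ _ _) (tri≈ _ _ _) ()
      classify-injective (tri≈ _ _ _) (tri< _ _ _) ()
      classify-injective (tri≈ _ _ _) (tri> _ _ _) ()

    toCode : NonPalindrome (2 + L) → Code
    toCode (w , np) =
      classify (head w) (last w) (inner w) (λ h≡l → np ∘ palindrome-from-ends h≡l) (<-cmp (head w) (last w))

    fromCode : Code → NonPalindrome (2 + L)
    fromCode (inj₁ (((a , b) , a<b) , u)) =
      wrap a u b , λ p → <⇒≢ a<b (trans (palindrome-ends p) (last-∷ʳ u b))
    fromCode (inj₂ (a , u , np)) =
      wrap a u a , np ∘ palindrome-cong (init-∷ʳ u a) ∘ palindrome-inner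

    toCode-cong : ∀ {w v} → proj₁ w ≈ᴿ proj₁ v → toCode w ≈ᶜ toCode v
    toCode-cong (inj₁ e) = classify-cong (e zero) (e _) (λ j → e _) _ _
    toCode-cong {v = v , _} (inj₂ e) =
      classify-cong-reverse (e zero) (trans (e _) (last-reverse v)) (λ j → trans (e _) (inner-reverse v j)) _ _

    toCode-reflects : ∀ {w v} → toCode w ≈ᶜ toCode v → proj₁ w ≈ᴿ proj₁ v
    toCode-reflects {v = v , _} c with classify-injective _ _ c
    ... | inj₁ (h , l , i) = inj₁ (≗-ends h l i)
    ... | inj₂ (h , l , i) =
      inj₂ (≗-ends h (trans l (sym (last-reverse v))) (λ j → trans (i j) (sym (inner-reverse v j))))

    toCode-fromCode : ∀ c → toCode (fromCode c) ≈ᶜ c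
    toCode-fromCode c@(inj₁ (((a , b) , a<b) , u)) =
      subst (toCode (fromCode c) ≈ᶜ_) (classify-< {np = λ a≡b _ → <⇒≢ a<b a≡b} a<b (<-cmp a b))
            (classify-cong refl (last-∷ʳ u b) (init-∷ʳ u b) _ _)
    toCode-fromCode c@(inj₂ (a , u , np)) =
      subst (toCode (fromCode c) ≈ᶜ_) (classify-≡ {np = λ _ → np} refl (<-cmp a a))
            (classify-cong refl (last-∷ʳ u a) (init-∷ʳ u a) _ _)

  nonPalindrome-enumeration : ∀ L → Enumeration (_≈ᴿ_ on proj₁) (nonPalindromeClasses L)
  nonPalindrome-enumeration 0             = empty-enumeration λ (_ , np) → np λ ()
  nonPalindrome-enumeration 1             = empty-enumeration λ (_ , np) → np λ { zero → refl }
  nonPalindrome-enumeration (suc (suc L)) =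
    enumeration-via toCode fromCode
                    (λ {w} {v} → toCode-cong {w = w} {v}) (λ {w} {v} → toCode-reflects {w = w} {v})
                    toCode-fromCode
      (⊎-enumeration (×-enumeration (increasing-enumeration r) (word-enumeration L))
                     (×-enumeration fin-enumeration (nonPalindrome-enumeration L)))

  nonPalindromeClasses-double : ∀ L → nonPalindromeClasses L * 2 + r ^ ⌈ L /2⌉ ≡ r ^ L
  nonPalindromeClasses-double 0             = refl
  nonPalindromeClasses-double 1             = refl
  nonPalindromeClasses-double (suc (suc L)) = begin
    (T * p + r * N) * 2 + r * q    ≡⟨ regroup T p r N q ⟩
    T * 2 * p + r * (N * 2 + q)    ≡⟨ cong (λ x → T * 2 * p + r * x) (nonPalindromeClasses-double L) ⟩
    T * 2 * p + r * p              ≡⟨ ℕ.*-distribʳ-+ p (T * 2) r ⟨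
    (T * 2 + r) * p                ≡⟨ cong (_* p) (triangle-double r) ⟩
    r * r * p                      ≡⟨ ℕ.*-assoc r r p ⟩
    r * (r * p)                    ∎
    where
    open ≡-Reasoning
    T = triangle r
    N = nonPalindromeClasses L
    p = r ^ L
    q = r ^ ⌈ L /2⌉
    regroup : ∀ T p r N q → (T * p + r * N) * 2 + r * q ≡ T * 2 * p + r * (N * 2 + q)
    regroup = solve-∀

  nonPalindromeClasses-formula : ∀ L → (r ^ L ∸ r ^ ⌈ L /2⌉) / 2 ≡ nonPalindromeClasses L
  nonPalindromeClasses-formula L = begin
    (r ^ L ∸ q) / 2      ≡⟨ cong (λ x → (x ∸ q) / 2) (nonPalindromeClasses-double L) ⟨
    (N * 2 + q ∸ q) / 2  ≡⟨ cong (_/ 2) (ℕ.m+n∸n≡m (N * 2) q) ⟩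
    N * 2 / 2            ≡⟨ m*n/n≡m N 2 ⟩
    N                    ∎
    where
    open ≡-Reasoning
    N = nonPalindromeClasses L
    q = r ^ ⌈ L /2⌉

windmillBound⇔≤nonPalindromeClasses : ∀ n L r →
                                      WindmillBound n (suc L) r ⇔ n ≤ Words.nonPalindromeClasses r L
windmillBound⇔≤nonPalindromeClasses n L r = mk⇔ (subst (n ≤_) formula) (subst (n ≤_) (sym formula))
  where formula = Words.nonPalindromeClasses-formula r L

-- The Dutch windmill

involution⇒automorphism : (G : Graph) (f : V G → V G) → (∀ x → f (f x) ≡ x) →
                          f Preserves Adj G ⟶ Adj G → Automorphism G
involution⇒automorphism G f f∘f adj = record
  { perm     = mk↔ₛ′ f f f∘f f∘f
  ; preserve = λ x y → mk⇔ adj (subst₂ (Adj G) (f∘f x) (f∘f y) ∘ adj)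
  }

module _ {G : Graph} (σ : Automorphism G) where

  automorphism-adj : Inverse.to (perm σ) Preserves Adj G ⟶ Adj G
  automorphism-adj {x} {y} = Equivalence.to (preserve σ x y)

  automorphism-injective : Injective _≡_ _≡_ (Inverse.to (perm σ))
  automorphism-injective = Injection.injective (↔⇒↣ (perm σ))

module Windmill (n m : ℕ) where

  L : ℕ
  L = 2 + m

  G : Graph
  G = DutchWindmill n (suc L)

  Vertex : Set
  Vertex = V G

  _~_ : Vertex → Vertex → Set
  _~_ = Adj G

  pattern hub       = nothing
  pattern blade i j = just (i , j)

  End : Fin L → Set
  End j = toℕ j ≡ 0 ⊎ toℕ j ≡ suc m

  data NeighbourOfHub : Vertex → Set where
    end : ∀ {i j} → End j → NeighbourOfHub (blade i j)

  neighbour-of-hub : ∀ {y} → hub ~ y → NeighbourOfHub y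
  neighbour-of-hub (inj₁ (hub-first _ _ e)) = end (inj₁ e)
  neighbour-of-hub (inj₁ (hub-last _ _ e))  = end (inj₂ e)

  data NeighbourOfBlade (i : Fin n) (j : Fin L) : Vertex → Set where
    via-hub : NeighbourOfBlade i j hub
    above   : ∀ {j′} → suc (toℕ j) ≡ toℕ j′ → NeighbourOfBlade i j (blade i j′)
    below   : ∀ {j′} → suc (toℕ j′) ≡ toℕ j → NeighbourOfBlade i j (blade i j′)

  neighbour-of-blade : ∀ {i j y} → blade i j ~ y → NeighbourOfBlade i j y
  neighbour-of-blade (inj₁ (step _ _ _ e))    = above e
  neighbour-of-blade (inj₂ (hub-first _ _ _)) = via-hub
  neighbour-of-blade (inj₂ (hub-last _ _ _))  = via-hub
  neighbour-of-blade (inj₂ (step _ _ _ e))    = below e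

  direction : ∀ {i j y} → NeighbourOfBlade i j y → Fin 3
  direction via-hub   = zero
  direction (above _) = suc zero
  direction (below _) = suc (suc zero)

  direction-injective : ∀ {i j y y′} (p : NeighbourOfBlade i j y) (q : NeighbourOfBlade i j y′) →
                        direction p ≡ direction q → y ≡ y′
  direction-injective via-hub   via-hub    _ = refl
  direction-injective (above e) (above e′) _ = cong (blade _) (toℕ-injective (trans (sym e) e′))
  direction-injective (below e) (below e′) _ =
    cong (blade _) (toℕ-injective (ℕ.suc-injective (trans e (sym e′))))
  direction-injective via-hub   (above _)  ()
  direction-injective via-hub   (below _)  ()
  direction-injective (above _) via-hub    ()
  direction-injective (above _) (below _)  ()
  direction-injective (below _) via-hub    ()
  direction-injective (below _) (above _)  ()

  orient : Bool → Fin L → Fin L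
  orient false = id
  orient true  = opposite

  orient-involutive : ∀ c j → orient c (orient c j) ≡ j
  orient-involutive false j = refl
  orient-involutive true  j = opposite-involutive j

  opposite-first : ∀ {j : Fin L} → toℕ j ≡ 0 → toℕ (opposite j) ≡ suc m
  opposite-first {j} e = trans (opposite-prop j) (cong (λ t → L ∸ suc t) e)

  opposite-last : ∀ {j : Fin L} → toℕ j ≡ suc m → toℕ (opposite j) ≡ 0
  opposite-last {j} e = trans (opposite-prop j) (trans (cong (λ t → L ∸ suc t) e) (ℕ.n∸n≡0 m))

  opposite-end : ∀ {j : Fin L} → End j → End (opposite j)
  opposite-end = Sum.swap ∘ Sum.map opposite-first opposite-last

  bladeMap : (Fin n → Fin n × Bool) → Vertex → Vertex
  bladeMap β hub         = hub
  bladeMap β (blade i j) = blade (proj₁ (β i)) (orient (proj₂ (β i)) j)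

  bladeMap-adj : ∀ β → bladeMap β Preserves _~_ ⟶ _~_
  bladeMap-adj β (inj₁ e) = edge e
    where
    hub-edge : ∀ {i j} → End j → hub ~ blade i j
    hub-edge (inj₁ e) = inj₁ (hub-first _ _ e)
    hub-edge (inj₂ e) = inj₁ (hub-last _ _ e)

    orient-end : ∀ c {j} → End j → End (orient c j)
    orient-end false = id
    orient-end true  = opposite-end

    edge : ∀ {x y} → WEdge n (suc L) x y → bladeMap β x ~ bladeMap β y
    edge (hub-first i _ e) = hub-edge (orient-end (proj₂ (β i)) (inj₁ e))
    edge (hub-last i _ e)  = hub-edge (orient-end (proj₂ (β i)) (inj₂ e))
    edge (step i _ _ e) with proj₂ (β i)
    ... | false = inj₁ (step _ _ _ e)
    ... | true  = inj₂ (step _ _ _ (opposite-step e))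
  bladeMap-adj β (inj₂ e) = Sum.swap (bladeMap-adj β (inj₁ e))

  bladeMap-involutive : ∀ β → (∀ i → β (proj₁ (β i)) ≡ (i , proj₂ (β i))) →
                        ∀ y → bladeMap β (bladeMap β y) ≡ y
  bladeMap-involutive β β-inv hub         = refl
  bladeMap-involutive β β-inv (blade i j) = begin
    blade (proj₁ (β i′)) (orient (proj₂ (β i′)) (orient c j))
      ≡⟨ cong (λ (i″ , c′) → blade i″ (orient c′ (orient c j))) (β-inv i) ⟩
    blade i (orient c (orient c j))
      ≡⟨ cong (blade i) (orient-involutive c j) ⟩
    blade i j
      ∎
    where
    open ≡-Reasoning
    i′ = proj₁ (β i)
    c  = proj₂ (β i)

  module _ (i i′ : Fin n) (b : Bool) where

    exchange : Fin n → Fin n × Bool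
    exchange x with x ≟ i
    ... | yes _ = i′ , b
    ... | no _ with x ≟ i′
    ...   | yes _ = i , b
    ...   | no _  = x , false

    exchange-at : exchange i ≡ (i′ , b)
    exchange-at with i ≟ i
    ... | yes _ = refl
    ... | no i≢i = contradiction refl i≢i

    exchange-involutive : ∀ x → exchange (proj₁ (exchange x)) ≡ (x , proj₂ (exchange x))
    exchange-involutive x with x ≟ i
    exchange-involutive x | yes refl with i′ ≟ x
    ... | yes refl = refl
    ... | no _ with i′ ≟ i′
    ...   | yes _ = refl
    ...   | no i′≢i′ = contradiction refl i′≢i′
    exchange-involutive x | no x≢i with x ≟ i′
    ... | yes refl = exchange-at
    ... | no x≢i′ with x ≟ i
    ...   | yes x≡i = contradiction x≡i x≢i
    ...   | no _ with x ≟ i′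
    ...     | yes x≡i′ = contradiction x≡i′ x≢i′
    ...     | no _ = refl

    exchangeAutomorphism : Automorphism G
    exchangeAutomorphism =
      involution⇒automorphism G (bladeMap exchange) (bladeMap-involutive exchange exchange-involutive)
                              (bladeMap-adj exchange)

    exchange-preserves-labels : ∀ {A : Set} (φ : Vertex → A) →
                                (∀ j → φ (blade i j) ≡ φ (blade i′ (orient b j))) →
                                ∀ y → φ y ≡ φ (bladeMap exchange y)
    exchange-preserves-labels φ H hub = refl
    exchange-preserves-labels φ H (blade x j) with x ≟ i
    ... | yes refl = H j
    ... | no _ with x ≟ i′
    ...   | yes refl = trans (cong (φ ∘ blade x) (sym (orient-involutive b j))) (sym (H (orient b j)))
    ...   | no _ = refl

  reverseBlade : Fin n → Vertex → Vertex
  reverseBlade i = bladeMap (exchange i i true)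

  reverseBlade-at : ∀ i j → reverseBlade i (blade i j) ≡ blade i (opposite j)
  reverseBlade-at i j = cong (λ (i′ , c) → blade i′ (orient c j)) (exchange-at i i true)

  reverseBlade-involutive : ∀ i y → reverseBlade i (reverseBlade i y) ≡ y
  reverseBlade-involutive i = bladeMap-involutive _ (exchange-involutive i i true)

  -- With i = i′ and c = true this says the blade words are not palindromes.
  Separated : ∀ {A : Set} → (Vertex → A) → Set
  Separated φ = ∀ {i i′} c → (∀ j → φ (blade i j) ≡ φ (blade i′ (orient c j))) → i ≡ i′ × c ≡ false

  distinguishing⇒separated : ∀ {r} {φ : Vertex → Fin r} → IsDistinguishing G r φ → Separated φ
  distinguishing⇒separated {φ = φ} dist {i} {i′} c H =
    fixed c (trans (sym moved) (dist (exchangeAutomorphism i i′ c) (exchange-preserves-labels i i′ c φ H)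
                                     (blade i zero)))
    where
    moved : bladeMap (exchange i i′ c) (blade i zero) ≡ blade i′ (orient c zero)
    moved = cong (λ (i″ , c′) → blade i″ (orient c′ zero)) (exchange-at i i′ c)
    fixed : ∀ c → blade i′ (orient c zero) ≡ blade i zero → i ≡ i′ × c ≡ false
    fixed false refl = refl , refl
    fixed true  ()

  module Embedding {f : Vertex → Vertex} (f-adj : f Preserves _~_ ⟶ _~_)
                   (f-injective : Injective _≡_ _≡_ f) where

    -- If f hub were a blade vertex, f would send the four corners to distinct neighbours of it,
    -- but those are told apart by a direction in Fin 3.
    fixes-hub : ∀ {i₀ i₁} → i₀ ≢ i₁ → f hub ≡ hub
    fixes-hub {i₀} {i₁} i₀≢i₁ with f hub in f-hub
    ... | hub         = refl
    ... | blade x₀ j₀ = contradiction (injective⇒≤ direction∘f-injective) (ℕ.<-irrefl refl)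
      where
      lastPosition : Fin L
      lastPosition = opposite zero

      corner : Fin 4 → Vertex
      corner zero                   = blade i₀ zero
      corner (suc zero)             = blade i₀ lastPosition
      corner (suc (suc zero))       = blade i₁ zero
      corner (suc (suc (suc zero))) = blade i₁ lastPosition

      corner-adj : ∀ q → hub ~ corner q
      corner-adj zero                   = inj₁ (hub-first _ _ refl)
      corner-adj (suc zero)             = inj₁ (hub-last _ _ (opposite-prop {L} zero))
      corner-adj (suc (suc zero))       = inj₁ (hub-first _ _ refl)
      corner-adj (suc (suc (suc zero))) = inj₁ (hub-last _ _ (opposite-prop {L} zero))

      whichCorner : Vertex → Fin 4
      whichCorner hub               = zero
      whichCorner (blade x zero)    = if does (x ≟ i₀) then zero else suc (suc zero)
      whichCorner (blade x (suc _)) = if does (x ≟ i₀) then suc zero else suc (suc (suc zero))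

      whichCorner-corner : ∀ q → whichCorner (corner q) ≡ q
      whichCorner-corner zero                   rewrite dec-true (i₀ ≟ i₀) refl = refl
      whichCorner-corner (suc zero)             rewrite dec-true (i₀ ≟ i₀) refl = refl
      whichCorner-corner (suc (suc zero))       rewrite dec-false (i₁ ≟ i₀) (i₀≢i₁ ∘ sym) = refl
      whichCorner-corner (suc (suc (suc zero))) rewrite dec-false (i₁ ≟ i₀) (i₀≢i₁ ∘ sym) = refl

      neighbour : ∀ q → NeighbourOfBlade x₀ j₀ (f (corner q))
      neighbour q = neighbour-of-blade (subst (_~ f (corner q)) f-hub (f-adj (corner-adj q)))

      direction∘f-injective : Injective _≡_ _≡_ (λ q → direction (neighbour q))
      direction∘f-injective {q} {q′} e =
        trans (sym (whichCorner-corner q))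
              (trans (cong whichCorner (f-injective (direction-injective (neighbour q) (neighbour q′) e)))
                     (whichCorner-corner q′))

    module _ (f-hub : f hub ≡ hub) {i i′ : Fin n} (f-first : f (blade i zero) ≡ blade i′ zero) where

      Predecessors : Fin L → Set
      Predecessors j = ∀ {j⁻} → suc (toℕ j⁻) ≡ toℕ j → f (blade i j⁻) ≡ blade i′ j⁻

      advance : ∀ {j j⁺} → f (blade i j) ≡ blade i′ j → Predecessors j → suc (toℕ j) ≡ toℕ j⁺ →
                f (blade i j⁺) ≡ blade i′ j⁺
      advance {j} {j⁺} fj fpred e =
        by-neighbour (neighbour-of-blade (subst (_~ f (blade i j⁺)) fj (f-adj (inj₁ (step i j j⁺ e))))) refl
        where
        by-neighbour : ∀ {y} → NeighbourOfBlade i′ j y → f (blade i j⁺) ≡ y →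
                       f (blade i j⁺) ≡ blade i′ j⁺
        by-neighbour via-hub    eq = contradiction (f-injective (trans eq (sym f-hub))) λ ()
        by-neighbour (above e′) eq = trans eq (cong (blade i′) (toℕ-injective (trans (sym e′) e)))
        by-neighbour (below {j′} e′) eq =
          contradiction (ℕ.<-trans (ℕ.≤-reflexive e′) (ℕ.≤-reflexive e)) (ℕ.<-irrefl (sym pos))
          where
          pos : toℕ j⁺ ≡ toℕ j′
          pos = cong (toℕ ∘ proj₂) (just-injective (f-injective (trans eq (sym (fpred e′)))))

      blade-rigid : ∀ j → f (blade i j) ≡ blade i′ j
      blade-rigid = proj₁ ∘ <-weakInduction (λ j → f (blade i j) ≡ blade i′ j × Predecessors j)
                                            (f-first , λ ()) next
        where
        next : ∀ j → f (blade i (inject₁ j)) ≡ blade i′ (inject₁ j) × Predecessors (inject₁ j) →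
               f (blade i (suc j)) ≡ blade i′ (suc j) × Predecessors (suc j)
        next j (fj , fpred) =
          advance fj fpred (cong suc (toℕ-inject₁ j)) ,
          λ e → subst (λ j⁻ → f (blade i j⁻) ≡ blade i′ j⁻)
                      (toℕ-injective (trans (toℕ-inject₁ j) (sym (ℕ.suc-injective e)))) fj

  maps-blades : ∀ {f} → f Preserves _~_ ⟶ _~_ → Injective _≡_ _≡_ f → f hub ≡ hub →
                ∀ i → ∃₂ λ i′ c → ∀ j → f (blade i j) ≡ blade i′ (orient c j)
  maps-blades {f} f-adj f-injective f-hub i =
    by-neighbour (neighbour-of-hub (subst (_~ f (blade i zero)) f-hub (f-adj (inj₁ (hub-first i zero refl))))) refl
    where
    by-neighbour : ∀ {y} → NeighbourOfHub y → f (blade i zero) ≡ y →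
                   ∃₂ λ i′ c → ∀ j → f (blade i j) ≡ blade i′ (orient c j)
    by-neighbour (end {i′} (inj₁ e)) eq =
      i′ , false , Embedding.blade-rigid f-adj f-injective f-hub (trans eq (cong (blade i′) (toℕ-injective e)))
    -- Composing f with the reversal of blade i′ brings us back to the unreversed case.
    by-neighbour (end {i′} {j₀} (inj₂ e)) eq = i′ , true , λ j → begin
      f (blade i j)          ≡⟨ reverseBlade-involutive i′ _ ⟨
      ρ (ρ (f (blade i j)))  ≡⟨ cong ρ (Embedding.blade-rigid ρ∘f-adj ρ∘f-injective (cong ρ f-hub) ρ∘f-first j) ⟩
      ρ (blade i′ j)         ≡⟨ reverseBlade-at i′ j ⟩
      blade i′ (opposite j)  ∎
      where
      open ≡-Reasoning
      ρ = reverseBlade i′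
      ρ∘f-adj : (ρ ∘ f) Preserves _~_ ⟶ _~_
      ρ∘f-adj = bladeMap-adj _ ∘ f-adj
      ρ∘f-injective : Injective _≡_ _≡_ (ρ ∘ f)
      ρ∘f-injective e =
        f-injective (trans (sym (reverseBlade-involutive i′ _)) (trans (cong ρ e) (reverseBlade-involutive i′ _)))
      ρ∘f-first : ρ (f (blade i zero)) ≡ blade i′ zero
      ρ∘f-first =
        trans (cong ρ eq) (trans (reverseBlade-at i′ j₀) (cong (blade i′) (toℕ-injective (opposite-last e))))

  separated⇒distinguishing : ∀ {r} {φ : Vertex → Fin r} {i₀ i₁ : Fin n} → i₀ ≢ i₁ → Separated φ →
                             IsDistinguishing G r φ
  separated⇒distinguishing {φ = φ} i₀≢i₁ separated σ preserves = fixes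
    where
    σ-hub = Embedding.fixes-hub (automorphism-adj σ) (automorphism-injective σ) i₀≢i₁

    fixes : ∀ y → Inverse.to (perm σ) y ≡ y
    fixes hub = σ-hub
    fixes (blade i j) with maps-blades (automorphism-adj σ) (automorphism-injective σ) σ-hub i
    ... | i′ , c , σ-blade with separated c (λ j → trans (preserves (blade i j)) (cong φ (σ-blade j)))
    ...   | refl , refl = σ-blade j

  separated⇒bound : ∀ {r} {φ : Vertex → Fin r} → Separated φ → n ≤ Words.nonPalindromeClasses r L
  separated⇒bound {r} {φ} separated = injective⇒≤ code-injective
    where
    open Words r
    open Enumeration (nonPalindrome-enumeration L)

    word : Fin n → Word L
    word i j = φ (blade i j)

    nonPalindromic : ∀ i → ¬ Palindrome (word i)
    nonPalindromic i p with () ← proj₂ (separated true p)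

    code : Fin n → Fin (nonPalindromeClasses L)
    code i = encode (word i , nonPalindromic i)

    code-injective : Injective _≡_ _≡_ code
    code-injective {i} {i′} e with encode-injective {word i , nonPalindromic i} {word i′ , nonPalindromic i′} e
    ... | inj₁ u≗v  = proj₁ (separated false u≗v)
    ... | inj₂ u≗rv = proj₁ (separated true u≗rv)

  bound⇒separated : ∀ {r} → Fin n → n ≤ Words.nonPalindromeClasses r L → Σ (Vertex → Fin r) Separated
  bound⇒separated {r} i₀ n≤N = φ , separated
    where
    open Words r
    open Enumeration (nonPalindrome-enumeration L)

    word : Fin n → NonPalindrome L
    word i = decode (inject≤ i n≤N)

    -- The hub's label is irrelevant; it only has to exist.
    φ : Vertex → Fin r
    φ hub         = proj₁ (word i₀) zero
    φ (blade i j) = proj₁ (word i) j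

    orient-≈ᴿ : ∀ {u v : Word L} c → (∀ j → u j ≡ v (orient c j)) → u ≈ᴿ v
    orient-≈ᴿ false = inj₁
    orient-≈ᴿ true  = inj₂

    separated : Separated φ
    separated {i} {i′} c H with inject≤-injective n≤N n≤N i i′
      (trans (sym (encode-decode _)) (trans (encode-cong {word i} {word i′} (orient-≈ᴿ c H)) (encode-decode _)))
    ... | refl = refl , unreversed c H
      where
      unreversed : ∀ c → (∀ j → φ (blade i j) ≡ φ (blade i (orient c j))) → c ≡ false
      unreversed false _ = refl
      unreversed true  p = contradiction p (proj₂ (word i))

  distinguishing⇔windmillBound : ∀ {r} {i₀ i₁ : Fin n} → i₀ ≢ i₁ →
                                 HasDistinguishingLabeling G r ⇔ WindmillBound n (suc L) r
  distinguishing⇔windmillBound {r} {i₀} i₀≢i₁ = mk⇔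
    (λ (φ , distinguishing) → from (separated⇒bound {φ = φ} (distinguishing⇒separated distinguishing)))
    (λ bound → let φ , separated = bound⇒separated i₀ (to bound) in φ , separated⇒distinguishing i₀≢i₁ separated)
    where open Equivalence (windmillBound⇔≤nonPalindromeClasses n L r) using (to; from)

least-witness : ∀ {P : ℕ → Set} → Decidable P → ∀ w → P w → Σ ℕ (IsLeast P)
least-witness P? zero    Pw = 0 , Pw , λ _ _ → z≤n
least-witness P? (suc w) Pw with P? 0
... | yes P0 = 0 , P0 , λ _ _ → z≤n
... | no ¬P0 with least-witness (P? ∘ suc) w Pw
...   | m , Pm , least = suc m , Pm , λ { zero P0 → contradiction P0 ¬P0 ; (suc s) Ps → s≤s (least s Ps) }

IsLeast-⇔ : ∀ {P Q : ℕ → Set} {m} → (∀ r → P r ⇔ Q r) → IsLeast P m → IsLeast Q m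
IsLeast-⇔ P⇔Q (Pm , least) = Equivalence.to (P⇔Q _) Pm , λ s Qs → least s (Equivalence.from (P⇔Q s) Qs)

n≤nonPalindromeClasses[1+n] : ∀ n m → n ≤ Words.nonPalindromeClasses (suc n) (2 + m)
n≤nonPalindromeClasses[1+n] n m = begin
  n                                       ≤⟨ ℕ.m≤m+n n (triangle n) ⟩
  triangle (suc n)                        ≤⟨ ℕ.m≤m*n _ _ {{ℕ.m^n≢0 (suc n) m}} ⟩
  triangle (suc n) * suc n ^ m            ≤⟨ ℕ.m≤m+n _ _ ⟩
  Words.nonPalindromeClasses (suc n) (2 + m) ∎
  where open ℕ.≤-Reasoning

mainTheorem5 : (n k : ℕ) → 2 ≤ n → 3 ≤ k →
    ∃ λ m → DistinguishingNumberIs (DutchWindmill n k) m × IsLeast (WindmillBound n k) m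
mainTheorem5 n@(suc (suc _)) (suc (suc (suc m))) (s≤s (s≤s z≤n)) (s≤s (s≤s (s≤s z≤n))) =
  let D , least = least-witness (λ r → n ℕ.≤? _) (suc n) bound-at-1+n
  in D , IsLeast-⇔ (λ _ → ⇔-sym (distinguishing⇔windmillBound {i₀ = zero} {suc zero} λ ())) least , least
  where
  open Windmill n m
  bound-at-1+n : WindmillBound n (suc L) (suc n)
  bound-at-1+n = Equivalence.from (windmillBound⇔≤nonPalindromeClasses n L (suc n)) (n≤nonPalindromeClasses[1+n] n m)
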